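{- Let $G=(V,E)$ be a connected undirected graph and $W\subseteq V$. If $T$ is a partial Steiner tree of $(G,W)$, then there is a minimal Steiner tree of $(G,W)$ that contains $T$ as a subgraph.
   Context: A partial Steiner tree of $(G,W)$ is a subgraph $T$ of $G$ that is a tree and all of whose leaves belong to $W$ (terminals of $W$ need not all lie in $T$). A Steiner subgraph of $(G,W)$ is a subgraph of $G$ containing a path between every pair of vertices of $W$; a minimal Steiner tree of $(G,W)$ is a Steiner subgraph of $(G,W)$ none of whose proper subgraphs is a Steiner subgraph of $(G,W)$. -}

module Defs where

open import Data.Nat using (ℕ; _≤_)
open import Data.Fin using (Fin)
open import Data.Bool using (Bool; true; false)
open import Data.List using (List; []; _∷_; length; filterᵇ; allFin)
open import Data.List.Relation.Unary.Unique.Propositional using (Unique)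
open import Data.Product using (Σ; ∃; ∃-syntax; _×_; proj₁)
open import Relation.Binary.PropositionalEquality using (_≡_; refl)
open import Relation.Nullary using (¬_)

record Graph (n : ℕ) : Set where
  field
    adj     : Fin n → Fin n → Bool
    adj-sym : ∀ u v → adj u v ≡ adj v u
    adj-irr : ∀ v → adj v v ≡ false
open Graph public

record Subgraph {n : ℕ} (G : Graph n) : Set where
  field
    vert     : Fin n → Bool
    edge     : Fin n → Fin n → Bool
    edge-sym : ∀ u v → edge u v ≡ edge v u
    edge-adj : ∀ u v → edge u v ≡ true → adj G u v ≡ true
    edge-end : ∀ u v → edge u v ≡ true → vert u ≡ true
open Subgraph public

_⊆ₛ_ : ∀ {n} {G : Graph n} → Subgraph G → Subgraph G → Set
H ⊆ₛ K = (∀ v → vert H v ≡ true → vert K v ≡ true)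
       × (∀ u v → edge H u v ≡ true → edge K u v ≡ true)

data Walk {n : ℕ} {G : Graph n} (H : Subgraph G) : Fin n → Fin n → Set where
  [_]  : ∀ {u} → vert H u ≡ true → Walk H u u
  _∷⟨_⟩_ : ∀ {v} u {w} → edge H u w ≡ true → Walk H w v → Walk H u v

verts : ∀ {n} {G : Graph n} {H : Subgraph G} {u v} → Walk H u v → List (Fin n)
verts ([_] {u} _) = u ∷ []
verts (u ∷⟨ _ ⟩ p) = u ∷ verts p

Path : ∀ {n} {G : Graph n} → Subgraph G → Fin n → Fin n → Set
Path H u v = Σ (Walk H u v) λ p → Unique (verts p)

HasCycle : ∀ {n} {G : Graph n} → Subgraph G → Set
HasCycle {n} H = ∃[ u ] ∃[ w ] Σ (Path H u w) λ p →
  (3 ≤ length (verts (proj₁ p))) × (edge H w u ≡ true)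

ConnectedSub : ∀ {n} {G : Graph n} → Subgraph G → Set
ConnectedSub H = ∀ u v → vert H u ≡ true → vert H v ≡ true → Path H u v

wholeGraph : ∀ {n} (G : Graph n) → Subgraph G
wholeGraph G = record
  { vert = λ _ → true ; edge = adj G ; edge-sym = adj-sym G
  ; edge-adj = λ _ _ e → e ; edge-end = λ _ _ _ → refl }

Connected : ∀ {n} → Graph n → Set
Connected G = ConnectedSub (wholeGraph G)

IsTree : ∀ {n} {G : Graph n} → Subgraph G → Set
IsTree H = (∃[ v ] vert H v ≡ true) × ConnectedSub H × ¬ HasCycle H

degree : ∀ {n} {G : Graph n} → Subgraph G → Fin n → ℕ
degree {n} H v = length (filterᵇ (edge H v) (allFin n))

-- Leaf of H: a vertex of H of degree at most 1 in H (so the unique vertex of a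
-- one-vertex tree is a leaf; with 'exactly 1' the lemma would be false).
IsLeaf : ∀ {n} {G : Graph n} → Subgraph G → Fin n → Set
IsLeaf H v = (vert H v ≡ true) × (degree H v ≤ 1)

IsPartialSteinerTree : ∀ {n} (G : Graph n) (W : Fin n → Bool) → Subgraph G → Set
IsPartialSteinerTree G W T = IsTree T × (∀ v → IsLeaf T v → W v ≡ true)

IsSteinerSubgraph : ∀ {n} (G : Graph n) (W : Fin n → Bool) → Subgraph G → Set
IsSteinerSubgraph G W H = ∀ u v → W u ≡ true → W v ≡ true → Path H u v

_⊂ₛ_ : ∀ {n} {G : Graph n} → Subgraph G → Subgraph G → Set
H' ⊂ₛ H = (H' ⊆ₛ H) × ¬ (H ⊆ₛ H')

IsMinimalSteinerTree : ∀ {n} (G : Graph n) (W : Fin n → Bool) → Subgraph G → Set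
IsMinimalSteinerTree G W H =
  IsSteinerSubgraph G W H × (∀ H' → H' ⊂ₛ H → ¬ IsSteinerSubgraph G W H')

-- Starting from G, delete vertices and edges one at a time as long as the result is still a
-- Steiner subgraph containing T; this ends in a Steiner subgraph S ⊇ T from which no single
-- vertex or edge can be removed in this way. Every edge ab of T is essential in S: walking in
-- T away from ab on either side ends at leaves of T, which are terminals, so if S − ab were
-- Steiner there would be a path from a to b in S − ab. If that path ran inside T it would close
-- a cycle of T with ab; otherwise its first edge outside T lies on a cycle of S, and deleting it
-- keeps S Steiner. So every Steiner subgraph of S contains T, and then by the choice of S it
-- contains all of S.

module Submission where

open import Defs
open import Data.Bool using (Bool; true; false; _∧_; not)
open import Data.Bool.Properties using (∧-conicalˡ; ∧-zeroʳ) renaming (_≟_ to _≟ᵇ_)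
open import Data.Empty using (⊥; ⊥-elim)
open import Data.Fin using (Fin; zero; suc; remQuot; combine) renaming (_<_ to _<ᶠ_)
open import Data.Fin.Properties using (_≟_; any?; all?; ¬∀⟶∃¬; pigeonhole; remQuot-combine)
open import Data.Fin.Subset using (∣_∣) renaming (_∈_ to _∈ˢ_; _⊆_ to _⊆ˢ_)
open import Data.Fin.Subset.Properties using (p⊆q⇒∣p∣≤∣q∣; p⊂q⇒∣p∣<∣q∣)
open import Data.List using (List; []; _∷_; length; lookup; take; filterᵇ)
open import Data.List.Membership.Propositional using (_∈_; _∉_)
open import Data.List.Membership.Propositional.Properties using (∈-lookup)
import Data.List.Membership.DecPropositional as DecMembership
open import Data.List.Relation.Unary.All as All using (All; []; _∷_)
open import Data.List.Relation.Unary.All.Properties using (¬Any⇒All¬)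
open import Data.List.Relation.Unary.AllPairs using ([]; _∷_)
open import Data.List.Relation.Unary.Any using (here; there)
open import Data.List.Relation.Unary.Unique.Propositional using (Unique)
open import Data.List.Relation.Unary.Unique.Propositional.Properties using (allFin⁺; take⁺)
open import Data.Nat using (ℕ; zero; suc; _+_; _*_; _≤_; _<_; z≤n; s≤s; _≤?_)
open import Data.Nat.Induction using (<-wellFounded)
open import Data.Nat.Properties using (≰⇒>; ≤-pred; <-irrefl; ≤-trans; +-suc; m<m+n; +-mono-<-≤; +-mono-≤-<)
open import Data.Product using (Σ; ∃; ∃₂; _×_; _,_; proj₁; proj₂; uncurry)
open import Data.Sum using (_⊎_; inj₁; inj₂)
import Data.Sum as Sum
open import Data.Vec using (tabulate)
open import Data.Vec.Properties using (lookup∘tabulate; []=⇒lookup; lookup⇒[]=)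
open import Function using (_∘_; mk⇔)
open import Induction.WellFounded using (Acc; acc)
open import Relation.Binary.PropositionalEquality using (_≡_; _≢_; refl; sym; trans; cong; cong₂; subst)
open import Relation.Nullary using (¬_; Dec; yes; no; does; contradiction)
open import Relation.Nullary.Decidable using (_×-dec_; _⊎-dec_; _→-dec_; dec-true; dec-false; does-⇔)

≡true⇒≢false : ∀ {x} → x ≡ true → x ≢ false
≡true⇒≢false refl ()

module _ {A : Set} where

  ∧-not-does⁻ : ∀ x (A? : Dec A) → x ∧ not (does A?) ≡ true → x ≡ true × ¬ A
  ∧-not-does⁻ true  (no ¬a) _ = refl , ¬a
  ∧-not-does⁻ true  (yes _) ()
  ∧-not-does⁻ false _       ()

  ∧-not-does⁺ : ∀ {x} → x ≡ true → ¬ A → (A? : Dec A) → x ∧ not (does A?) ≡ true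
  ∧-not-does⁺ refl ¬a A? rewrite dec-false A? ¬a = refl

  ∧-not-does-false : ∀ x → A → (A? : Dec A) → x ∧ not (does A?) ≡ false
  ∧-not-does-false x a A? rewrite dec-true A? a = ∧-zeroʳ x

implies? : ∀ x y → Dec (x ≡ true → y ≡ true)
implies? x y = (x ≟ᵇ true) →-dec (y ≟ᵇ true)

¬implies : ∀ {x y} → ¬ (x ≡ true → y ≡ true) → x ≡ true × y ≡ false
¬implies {true}  {true}  ¬x⇒y = contradiction (λ _ → refl) ¬x⇒y
¬implies {true}  {false} _    = refl , refl
¬implies {false}         ¬x⇒y = contradiction (λ ()) ¬x⇒y

∈-tabulate⁺ : ∀ {m} {f : Fin m → Bool} {i} → f i ≡ true → i ∈ˢ tabulate f
∈-tabulate⁺ {f = f} {i} fi = lookup⇒[]= i _ (trans (lookup∘tabulate f i) fi)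

∈-tabulate⁻ : ∀ {m} {f : Fin m → Bool} {i} → i ∈ˢ tabulate f → f i ≡ true
∈-tabulate⁻ {f = f} {i} i∈f = trans (sym (lookup∘tabulate f i)) ([]=⇒lookup i∈f)

module _ {m : ℕ} (f g : Fin m → Bool) where

  tabulate-⊆ : (∀ i → f i ≡ true → g i ≡ true) → tabulate f ⊆ˢ tabulate g
  tabulate-⊆ f⇒g {i} i∈f = ∈-tabulate⁺ (f⇒g i (∈-tabulate⁻ i∈f))

  ∣tabulate∣-mono : (∀ i → f i ≡ true → g i ≡ true) → ∣ tabulate f ∣ ≤ ∣ tabulate g ∣
  ∣tabulate∣-mono f⇒g = p⊆q⇒∣p∣≤∣q∣ (tabulate-⊆ f⇒g)

  ∣tabulate∣-strict : (∀ i → f i ≡ true → g i ≡ true) →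
                      ∀ i → f i ≡ false → g i ≡ true → ∣ tabulate f ∣ < ∣ tabulate g ∣
  ∣tabulate∣-strict f⇒g i fi gi = p⊂q⇒∣p∣<∣q∣
    (tabulate-⊆ f⇒g , i , ∈-tabulate⁺ gi , λ i∈f → ≡true⇒≢false (∈-tabulate⁻ i∈f) fi)

unique-length≤ : ∀ {n} {xs : List (Fin n)} → Unique xs → length xs ≤ n
unique-length≤ {n} {xs} xs! with length xs ≤? n
... | yes ≤n = ≤n
... | no ≰n with pigeonhole (≰⇒> ≰n) (lookup xs)
... | i , j , i<j , eq = contradiction eq (lookup-injective xs! i<j)
  where
  lookup-injective : ∀ {ys : List (Fin n)} → Unique ys → ∀ {i j} → i <ᶠ j → lookup ys i ≢ lookup ys j
  lookup-injective (y∉ys ∷ _)   {zero}  {suc j} _         = All.lookup y∉ys (∈-lookup j)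
  lookup-injective (_ ∷ ys!)    {suc i} {suc j} (s≤s i<j) = lookup-injective ys! i<j

some-member : ∀ {n} (f : Fin n → Bool) xs → 0 < length (filterᵇ f xs) → ∃ λ y → y ∈ xs × f y ≡ true
some-member f (x ∷ xs) pos with f x in fx
... | true  = x , here refl , fx
... | false = let y , y∈xs , fy = some-member f xs pos in y , there y∈xs , fy

other-member : ∀ {n} (f : Fin n → Bool) c {xs} → Unique xs → 1 < length (filterᵇ f xs) →
               ∃ λ y → f y ≡ true × y ≢ c
other-member f c {x ∷ xs} (x∉xs ∷ xs!) 1< with f x in fx
... | false = other-member f c xs! 1<
... | true with x ≟ c
...   | no  x≢c  = x , fx , x≢c
...   | yes refl = let y , y∈xs , fy = some-member f xs (≤-pred 1<) in
                   y , fy , λ y≡x → All.lookup x∉xs y∈xs (sym y≡x)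

module _ {n : ℕ} {G : Graph n} where

  open DecMembership (_≟_ {n}) using (_∈?_)

  variable
    H K : Subgraph G
    a b c u v w x y z : Fin n

  no-loop : (H : Subgraph G) → edge H v v ≡ true → ⊥
  no-loop {v = v} H e = ≡true⇒≢false (edge-adj H v v e) (adj-irr G v)

  SameEdge : Fin n → Fin n → Fin n → Fin n → Set
  SameEdge a b u v = (u ≡ a × v ≡ b) ⊎ (u ≡ b × v ≡ a)

  sameEdge? : ∀ a b u v → Dec (SameEdge a b u v)
  sameEdge? a b u v = (u ≟ a ×-dec v ≟ b) ⊎-dec (u ≟ b ×-dec v ≟ a)

  sameEdge-swap : SameEdge a b u v → SameEdge a b v u
  sameEdge-swap (inj₁ (u≡a , v≡b)) = inj₂ (v≡b , u≡a)
  sameEdge-swap (inj₂ (u≡b , v≡a)) = inj₁ (v≡a , u≡b)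

  deleteEdge : Subgraph G → Fin n → Fin n → Subgraph G
  deleteEdge H a b = record
    { vert     = vert H
    ; edge     = λ u v → edge H u v ∧ not (does (sameEdge? a b u v))
    ; edge-sym = λ u v → cong₂ (λ e s → e ∧ not s) (edge-sym H u v)
                   (does-⇔ (mk⇔ sameEdge-swap sameEdge-swap) (sameEdge? a b u v) (sameEdge? a b v u))
    ; edge-adj = λ u v e → edge-adj H u v (∧-conicalˡ _ _ e)
    ; edge-end = λ u v e → edge-end H u v (∧-conicalˡ _ _ e)
    }

  deleteVertex : Subgraph G → Fin n → Subgraph G
  deleteVertex H x = record
    { vert     = λ v → vert H v ∧ not (does (v ≟ x))
    ; edge     = λ u v → edge H u v ∧ not (does (u ≟ x ⊎-dec v ≟ x))
    ; edge-sym = λ u v → cong₂ (λ e s → e ∧ not s) (edge-sym H u v)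
                   (does-⇔ (mk⇔ Sum.swap Sum.swap) (u ≟ x ⊎-dec v ≟ x) (v ≟ x ⊎-dec u ≟ x))
    ; edge-adj = λ u v e → edge-adj H u v (∧-conicalˡ _ _ e)
    ; edge-end = λ u v e → let e′ , u≢x = ∧-not-does⁻ _ (u ≟ x ⊎-dec v ≟ x) e
                           in ∧-not-does⁺ (edge-end H u v e′) (u≢x ∘ inj₁) (u ≟ x)
    }

  edge-deleteEdge⁻ : ∀ H a b → edge (deleteEdge H a b) u v ≡ true →
                     edge H u v ≡ true × ¬ SameEdge a b u v
  edge-deleteEdge⁻ {u = u} {v = v} H a b = ∧-not-does⁻ (edge H u v) (sameEdge? a b u v)

  edge-deleteEdge⁺ : ∀ H → edge H u v ≡ true → ¬ SameEdge a b u v → edge (deleteEdge H a b) u v ≡ true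
  edge-deleteEdge⁺ {u = u} {v = v} {a = a} {b = b} H e ¬ab = ∧-not-does⁺ e ¬ab (sameEdge? a b u v)

  deleteEdge-⊆ : ∀ H a b → deleteEdge H a b ⊆ₛ H
  deleteEdge-⊆ H a b = (λ _ h → h) , (λ _ _ → proj₁ ∘ edge-deleteEdge⁻ H a b)

  deleteEdge-mono : ∀ {K H} a b → K ⊆ₛ H → deleteEdge K a b ⊆ₛ deleteEdge H a b
  deleteEdge-mono {K} {H} a b (K⊆Hᵛ , K⊆Hᵉ) = K⊆Hᵛ , λ u v e →
    let e′ , ¬ab = edge-deleteEdge⁻ K a b e in edge-deleteEdge⁺ H (K⊆Hᵉ u v e′) ¬ab

  ⊆-deleteEdge : ∀ K H → K ⊆ₛ H → edge K a b ≡ false → K ⊆ₛ deleteEdge H a b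
  ⊆-deleteEdge {a = a} {b = b} K H (K⊆Hᵛ , K⊆Hᵉ) ab∉K =
    K⊆Hᵛ , λ u v e → edge-deleteEdge⁺ H (K⊆Hᵉ u v e) (not-ab e)
    where
    not-ab : ∀ {u v} → edge K u v ≡ true → ¬ SameEdge a b u v
    not-ab e (inj₁ (refl , refl)) = ≡true⇒≢false e ab∉K
    not-ab e (inj₂ (refl , refl)) = ≡true⇒≢false (trans (edge-sym K a b) e) ab∉K

  ⊆-deleteVertex : ∀ K H → K ⊆ₛ H → vert K x ≡ false → K ⊆ₛ deleteVertex H x
  ⊆-deleteVertex {x = x} K H (K⊆Hᵛ , K⊆Hᵉ) x∉K =
    (λ v h → ∧-not-does⁺ (K⊆Hᵛ v h) (x-absent h) (v ≟ x)) ,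
    (λ u v e → ∧-not-does⁺ (K⊆Hᵉ u v e)
                 (Sum.[ x-absent (edge-end K u v e) , x-absent (edge-end K v u (trans (edge-sym K v u) e)) ])
                 (u ≟ x ⊎-dec v ≟ x))
    where
    x-absent : vert K v ≡ true → v ≢ x
    x-absent h refl = ≡true⇒≢false h x∉K

  -- Greedy minimisation

  -- The ordered pair (u , v) sits at index combine u v of Fin (n * n).
  edgeIndicator : Subgraph G → Fin (n * n) → Bool
  edgeIndicator H k = uncurry (edge H) (remQuot n k)

  size : Subgraph G → ℕ
  size H = ∣ tabulate (vert H) ∣ + ∣ tabulate (edgeIndicator H) ∣

  size-deleteVertex : vert H x ≡ true → size (deleteVertex H x) < size H
  size-deleteVertex {H = H} {x = x} x∈H = +-mono-<-≤
    (∣tabulate∣-strict (vert (deleteVertex H x)) (vert H) (λ _ → ∧-conicalˡ _ _)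
      x (∧-not-does-false (vert H x) refl (x ≟ x)) x∈H)
    (∣tabulate∣-mono (edgeIndicator (deleteVertex H x)) (edgeIndicator H) (λ _ → ∧-conicalˡ _ _))

  size-deleteEdge : edge H a b ≡ true → size (deleteEdge H a b) < size H
  size-deleteEdge {H = H} {a = a} {b = b} ab∈H = +-mono-≤-<
    (∣tabulate∣-mono (vert H) (vert H) (λ _ h → h))
    (∣tabulate∣-strict (edgeIndicator (deleteEdge H a b)) (edgeIndicator H) (λ _ → ∧-conicalˡ _ _)
      (combine a b)
      (trans (cong (uncurry (edge (deleteEdge H a b))) (remQuot-combine a b))
             (∧-not-does-false (edge H a b) (inj₁ (refl , refl)) (sameEdge? a b a b)))
      (trans (cong (uncurry (edge H)) (remQuot-combine a b)) ab∈H))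

  LocallyMinimal : (Subgraph G → Set) → Subgraph G → Set
  LocallyMinimal P S = (∀ x → vert S x ≡ true → ¬ P (deleteVertex S x))
                     × (∀ a b → edge S a b ≡ true → ¬ P (deleteEdge S a b))

  locallyMinimal : {P : Subgraph G → Set} → (∀ H → Dec (P H)) →
                   P H → Σ (Subgraph G) λ S → P S × LocallyMinimal P S
  locallyMinimal {H = H} {P} P? pH = descend H pH (<-wellFounded (size H))
    where
    descend : ∀ S → P S → Acc _<_ (size S) → Σ (Subgraph G) λ S′ → P S′ × LocallyMinimal P S′
    descend S pS (acc smaller)
      with any? (λ x → (vert S x ≟ᵇ true) ×-dec P? (deleteVertex S x))
    ... | yes (x , x∈S , p) = descend (deleteVertex S x) p (smaller (size-deleteVertex {H = S} x∈S))
    ... | no no-vertex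
      with any? (λ a → any? λ b → (edge S a b ≟ᵇ true) ×-dec P? (deleteEdge S a b))
    ... | yes (a , b , ab∈S , p) = descend (deleteEdge S a b) p (smaller (size-deleteEdge {H = S} ab∈S))
    ... | no no-edge = S , pS , (λ x x∈S p → no-vertex (x , x∈S , p))
                               , (λ a b ab∈S p → no-edge (a , b , ab∈S , p))

  missing-vertex-or-edge : (S H : Subgraph G) → ¬ (S ⊆ₛ H) →
    (∃ λ x → vert S x ≡ true × vert H x ≡ false) ⊎
    (∃₂ λ a b → edge S a b ≡ true × edge H a b ≡ false)
  missing-vertex-or-edge S H S⊈H
    with all? (λ v → implies? (vert S v) (vert H v))
  ... | no ¬⊆ᵛ =
    let x , ¬x = ¬∀⟶∃¬ n _ (λ v → implies? (vert S v) (vert H v)) ¬⊆ᵛ in inj₁ (x , ¬implies ¬x)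
  ... | yes ⊆ᵛ
    with all? (λ a → all? λ b → implies? (edge S a b) (edge H a b))
  ... | yes ⊆ᵉ = ⊥-elim (S⊈H (⊆ᵛ , ⊆ᵉ))
  ... | no ¬⊆ᵉ =
    let a , ¬a = ¬∀⟶∃¬ n _ (λ a → all? λ b → implies? (edge S a b) (edge H a b)) ¬⊆ᵉ
        b , ¬b = ¬∀⟶∃¬ n _ (λ b → implies? (edge S a b) (edge H a b)) ¬a
    in inj₂ (a , b , ¬implies ¬b)

  mapWalk : H ⊆ₛ K → Walk H u v → Walk K u v
  mapWalk H⊆K [ u∈H ]      = [ proj₁ H⊆K _ u∈H ]
  mapWalk H⊆K (u ∷⟨ e ⟩ p) = u ∷⟨ proj₂ H⊆K _ _ e ⟩ mapWalk H⊆K p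

  verts-mapWalk : (H⊆K : H ⊆ₛ K) (p : Walk H u v) → verts (mapWalk {K = K} H⊆K p) ≡ verts p
  verts-mapWalk         H⊆K [ _ ]        = refl
  verts-mapWalk {K = K} H⊆K (u ∷⟨ _ ⟩ p) = cong (u ∷_) (verts-mapWalk {K = K} H⊆K p)

  mapPath : H ⊆ₛ K → Path H u v → Path K u v
  mapPath {K = K} H⊆K (p , p!) = mapWalk H⊆K p , subst Unique (sym (verts-mapWalk {K = K} H⊆K p)) p!

  isSteinerSubgraph-mono : ∀ {W} → H ⊆ₛ K → IsSteinerSubgraph G W H → IsSteinerSubgraph G W K
  isSteinerSubgraph-mono {K = K} H⊆K steiner u v u∈W v∈W = mapPath {K = K} H⊆K (steiner u v u∈W v∈W)

  _++ʷ_ : Walk H u v → Walk H v w → Walk H u w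
  [ _ ]        ++ʷ q = q
  (u ∷⟨ e ⟩ p) ++ʷ q = u ∷⟨ e ⟩ (p ++ʷ q)

  start-vert : Walk H u v → vert H u ≡ true
  start-vert [ u∈H ]                = u∈H
  start-vert {H = H} (u ∷⟨ e ⟩ _) = edge-end H u _ e

  reverseʷ : Walk H u v → Walk H v u
  reverseʷ [ u∈H ] = [ u∈H ]
  reverseʷ {H = H} (_∷⟨_⟩_ u {w} e p) =
    reverseʷ p ++ʷ (w ∷⟨ trans (edge-sym H w u) e ⟩ [ edge-end H u w e ])

  1≤length-verts : (p : Walk H u v) → 1 ≤ length (verts p)
  1≤length-verts [ _ ]       = s≤s z≤n
  1≤length-verts (_ ∷⟨ _ ⟩ _) = s≤s z≤n

  suffix : (p : Walk H x z) → Unique (verts p) → y ∈ verts p → Path H y z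
  suffix p@([ _ ])     p!       (here refl) = p , p!
  suffix p@(_ ∷⟨ _ ⟩ _) p!       (here refl) = p , p!
  suffix (_ ∷⟨ _ ⟩ p)   (_ ∷ p!) (there y∈p) = suffix p p! y∈p

  prefix : (p : Walk H x z) → y ∈ verts p → Σ (Walk H x y) λ q → ∃ λ k → verts q ≡ take k (verts p)
  prefix [ x∈H ]         (here refl) = [ x∈H ] , 1 , refl
  prefix {H = H} (x ∷⟨ e ⟩ p) (here refl) = [ edge-end H x _ e ] , 1 , refl
  prefix (x ∷⟨ e ⟩ p)    (there y∈p) =
    let q , k , q≡ = prefix p y∈p in (x ∷⟨ e ⟩ q) , suc k , cong (x ∷_) q≡

  shorten : Walk H u v → Path H u v
  shorten [ u∈H ] = [ u∈H ] , [] ∷ []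
  shorten (u ∷⟨ e ⟩ p) with shorten p
  ... | q , q! with u ∈? verts q
  ...   | yes u∈q = suffix q q! u∈q
  ...   | no  u∉q = (u ∷⟨ e ⟩ q) , ¬Any⇒All¬ _ u∉q ∷ q!

  walkWithin? : (H : Subgraph G) (v : Fin n) → ∀ k u → Dec (Σ (Walk H u v) λ p → length (verts p) ≤ k)
  walkWithin? H v zero u = no λ { ([ _ ] , ()) ; ((_ ∷⟨ _ ⟩ _) , ()) }
  walkWithin? H v (suc k) u with any? (λ w → (edge H u w ≟ᵇ true) ×-dec walkWithin? H v k w)
  ... | yes (w , e , p , ≤k) = yes ((u ∷⟨ e ⟩ p) , s≤s ≤k)
  ... | no no-step with u ≟ v
  ...   | no u≢v = no λ { ([ _ ] , _)                → u≢v refl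
                        ; ((_ ∷⟨ e ⟩ p) , s≤s ≤k) → no-step (_ , e , p , ≤k) }
  ...   | yes refl with vert H u ≟ᵇ true
  ...     | yes u∈H = yes ([ u∈H ] , s≤s z≤n)
  ...     | no  u∉H = no λ { ([ u∈H ] , _)             → u∉H u∈H
                           ; ((_ ∷⟨ e ⟩ p) , s≤s ≤k) → no-step (_ , e , p , ≤k) }

  path? : (H : Subgraph G) → ∀ u v → Dec (Path H u v)
  path? H u v with walkWithin? H v n u
  ... | yes (p , _) = yes (shorten p)
  ... | no  no-walk = no λ (p , p!) → no-walk (p , unique-length≤ p!)

  isSteinerSubgraph? : ∀ W (H : Subgraph G) → Dec (IsSteinerSubgraph G W H)
  isSteinerSubgraph? W H =
    all? λ u → all? λ v → (W u ≟ᵇ true) →-dec ((W v ≟ᵇ true) →-dec path? H u v)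

  ⊆ₛ? : (H K : Subgraph G) → Dec (H ⊆ₛ K)
  ⊆ₛ? H K = (all? λ v → implies? (vert H v) (vert K v))
      ×-dec (all? λ u → all? λ v → implies? (edge H u v) (edge K u v))

  SteinerAbove : (Fin n → Bool) → Subgraph G → Subgraph G → Set
  SteinerAbove W T H = IsSteinerSubgraph G W H × T ⊆ₛ H

  steinerAbove? : ∀ W T (H : Subgraph G) → Dec (SteinerAbove W T H)
  steinerAbove? W T H = isSteinerSubgraph? W H ×-dec ⊆ₛ? T H

  detour : Walk (deleteEdge H a b) b a → Walk H u v → Walk (deleteEdge H a b) u v
  detour back [ u∈H ] = [ u∈H ]
  detour {H = H} {a = a} {b = b} back (_∷⟨_⟩_ u {w} e p) with sameEdge? a b u w
  ... | no ¬ab                  = u ∷⟨ edge-deleteEdge⁺ H e ¬ab ⟩ detour back p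
  ... | yes (inj₁ (refl , refl)) = reverseʷ back ++ʷ detour back p
  ... | yes (inj₂ (refl , refl)) = back ++ʷ detour back p

  deleteEdge-on-cycle : ∀ {W} → Walk (deleteEdge H a b) b a →
                        IsSteinerSubgraph G W H → IsSteinerSubgraph G W (deleteEdge H a b)
  deleteEdge-on-cycle back steiner u v u∈W v∈W = shorten (detour back (proj₁ (steiner u v u∈W v∈W)))

  All-start : ∀ {P : Fin n → Set} (p : Walk H u v) → All P (verts p) → P u
  All-start [ _ ]        (Pu ∷ _) = Pu
  All-start (_ ∷⟨ _ ⟩ _) (Pu ∷ _) = Pu

  walk-avoiding : ∀ H a b → (p : Walk H u v) → All (a ≢_) (verts p) → Walk (deleteEdge H a b) u v
  walk-avoiding H a b [ u∈H ]               _             = [ u∈H ]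
  walk-avoiding H a b (_∷⟨_⟩_ u {w} e p) (a≢u ∷ a∉p) =
    u ∷⟨ edge-deleteEdge⁺ H e (λ { (inj₁ (u≡a , _)) → a≢u (sym u≡a)
                                  ; (inj₂ (_ , w≡a)) → All-start p a∉p (sym w≡a) }) ⟩
    walk-avoiding H a b p a∉p

  EdgeOnCycleOutside : Subgraph G → Subgraph G → Set
  EdgeOnCycleOutside K H =
    ∃₂ λ p q → edge H p q ≡ true × edge K p q ≡ false × Walk (deleteEdge H p q) q p

  -- Follow ω while it uses edges of K; its first edge outside K closes a cycle together
  -- with the rest of ω and the return walk in K.
  stays-or-leaves : K ⊆ₛ H → (ω : Walk H x y) → Unique (verts ω) → Walk K y x →
                    (Σ (Walk K x y) λ τ → verts τ ≡ verts ω) ⊎ EdgeOnCycleOutside K H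
  stays-or-leaves K⊆H [ _ ] _ back = inj₁ ([ start-vert back ] , refl)
  stays-or-leaves {K = K} {H = H} K⊆H (_∷⟨_⟩_ x {w} e ω) (x∉ω ∷ ω!) back with edge K x w in xw
  ... | true with stays-or-leaves {K = K} K⊆H ω ω!
                    (back ++ʷ (x ∷⟨ xw ⟩ [ edge-end K w x (trans (edge-sym K w x) xw) ]))
  ...   | inj₁ (τ , τ≡ω) = inj₁ ((x ∷⟨ xw ⟩ τ) , cong (x ∷_) τ≡ω)
  ...   | inj₂ cycle     = inj₂ cycle
  stays-or-leaves {K = K} {H = H} K⊆H (_∷⟨_⟩_ x {w} e ω) (x∉ω ∷ ω!) back | false =
    inj₂ (x , w , e , xw , walk-avoiding H x w ω x∉ω ++ʷ mapWalk (⊆-deleteEdge K H K⊆H xw) back)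

  3≤length-bypass : ∀ H → a ≢ b → (q : Walk (deleteEdge H a b) a b) → 3 ≤ length (verts q)
  3≤length-bypass H a≢b [ _ ] = ⊥-elim (a≢b refl)
  3≤length-bypass {a = a} {b = b} H a≢b (_ ∷⟨ e ⟩ [ _ ]) =
    ⊥-elim (proj₂ (edge-deleteEdge⁻ H a b e) (inj₁ (refl , refl)))
  3≤length-bypass H a≢b (_ ∷⟨ _ ⟩ (_ ∷⟨ _ ⟩ q)) = s≤s (s≤s (1≤length-verts q))

  -- Forests whose leaves are terminals

  other-neighbour : ∀ (H : Subgraph G) v c → 1 < degree H v → ∃ λ y → edge H v y ≡ true × y ≢ c
  other-neighbour H v c = other-member (edge H v) c (allFin⁺ n)

  module _ {W : Fin n → Bool} {T : Subgraph G} (acyclic : ¬ HasCycle T)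
           (leaves-in-W : ∀ v → IsLeaf T v → W v ≡ true) where

    fresh-neighbour : (e : edge T v c ≡ true) (ρ : Walk T c z) → Unique (v ∷ verts ρ) →
                      edge T v y ≡ true → y ≢ c → y ∉ v ∷ verts ρ
    fresh-neighbour e ρ            _     vy y≢c (here refl)         = no-loop T vy
    fresh-neighbour e [ _ ]        _     vy y≢c (there (here refl)) = y≢c refl
    fresh-neighbour e (_ ∷⟨ _ ⟩ _) _     vy y≢c (there (here refl)) = y≢c refl
    fresh-neighbour {v = v} {c = c} {y = y} e (_ ∷⟨ e′ ⟩ ρ) vcρ! vy y≢c (there (there y∈ρ)) =
      let q , k , q≡ = prefix ρ y∈ρ in
      acyclic (v , y , ((v ∷⟨ e ⟩ (c ∷⟨ e′ ⟩ q)) ,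
                        subst (λ l → Unique (v ∷ c ∷ l)) (sym q≡) (take⁺ (2 + k) vcρ!)) ,
               s≤s (s≤s (1≤length-verts q)) , trans (edge-sym T y v) vy)

    -- Leave v by an edge other than vc until reaching a leaf. By fresh-neighbour the walk stays
    -- a path, which has at most n vertices, so the fuel k never runs out.
    escape : ∀ {a b} k (e : edge T v c ≡ true) (ρ : Walk T c z) → Unique (v ∷ verts ρ) →
             a ∈ v ∷ verts ρ → b ∈ v ∷ verts ρ → n < k + length (v ∷ verts ρ) →
             ∃ λ t → W t ≡ true × Walk (deleteEdge T a b) v t
    escape zero e ρ vρ! _ _ n< = ⊥-elim (<-irrefl refl (≤-trans n< (unique-length≤ vρ!)))
    escape {v = v} {c = c} {a = a} {b = b} (suc k) e ρ vρ! a∈ b∈ n< with degree T v ≤? 1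
    ... | yes leaf = v , leaves-in-W v (edge-end T v c e , leaf) , [ edge-end T v c e ]
    ... | no ¬leaf =
      let y , vy , y≢c = other-neighbour T v c (≰⇒> ¬leaf)
          y∉ = fresh-neighbour e ρ vρ! vy y≢c
          t , t∈W , y⇝t = escape k (trans (edge-sym T y v) vy) (v ∷⟨ e ⟩ ρ) (¬Any⇒All¬ _ y∉ ∷ vρ!)
                            (there a∈) (there b∈) (subst (n <_) (sym (+-suc k _)) n<)
          vy≠ab : ¬ SameEdge a b v y
          vy≠ab = λ { (inj₁ (_ , y≡b)) → y∉ (subst (_∈ v ∷ verts ρ) (sym y≡b) b∈)
                    ; (inj₂ (_ , y≡a)) → y∉ (subst (_∈ v ∷ verts ρ) (sym y≡a) a∈) }
      in t , t∈W , (v ∷⟨ edge-deleteEdge⁺ T vy vy≠ab ⟩ y⇝t)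

    terminal-beyond : edge T v c ≡ true → SameEdge a b v c →
                      ∃ λ t → W t ≡ true × Walk (deleteEdge T a b) v t
    terminal-beyond {v = v} {c = c} e vc≡ab =
      escape n e [ c∈T ] (((λ { refl → no-loop T e }) ∷ []) ∷ [] ∷ [])
             (proj₁ (ends vc≡ab)) (proj₂ (ends vc≡ab)) (m<m+n n (s≤s z≤n))
      where
      c∈T : vert T c ≡ true
      c∈T = edge-end T c v (trans (edge-sym T c v) e)
      ends : SameEdge a b v c → a ∈ v ∷ c ∷ [] × b ∈ v ∷ c ∷ []
      ends (inj₁ (v≡a , c≡b)) = here (sym v≡a) , there (here (sym c≡b))
      ends (inj₂ (v≡b , c≡a)) = there (here (sym c≡a)) , here (sym v≡b)

  module _ {W : Fin n → Bool} {T S : Subgraph G} (acyclic : ¬ HasCycle T)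
           (leaves-in-W : ∀ v → IsLeaf T v → W v ≡ true)
           (steiner : IsSteinerSubgraph G W S) (T⊆S : T ⊆ₛ S)
           (locally-minimal : LocallyMinimal (SteinerAbove W T) S) where

    no-bypass : edge T a b ≡ true → ¬ Path (deleteEdge S a b) a b
    no-bypass {a = a} {b = b} ab∈T (ω , ω!)
      with stays-or-leaves {K = T} T⊆S (mapWalk (deleteEdge-⊆ S a b) ω)
             (subst Unique (sym (verts-mapWalk {K = S} (deleteEdge-⊆ S a b) ω)) ω!)
             (b ∷⟨ ba∈T ⟩ [ edge-end T a b ab∈T ])
      where ba∈T = trans (edge-sym T b a) ab∈T
    ... | inj₁ (τ , τ≡ω) = acyclic (a , b , (τ , subst Unique (sym τ≡ω′) ω!) ,
                                    subst (λ l → 3 ≤ length l) (sym τ≡ω′) (3≤length-bypass S a≢b ω) ,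
                                    trans (edge-sym T b a) ab∈T)
      where τ≡ω′ = trans τ≡ω (verts-mapWalk {K = S} (deleteEdge-⊆ S a b) ω)
            a≢b : a ≢ b
            a≢b refl = no-loop T ab∈T
    ... | inj₂ (p , q , pq∈S , pq∉T , back) =
      proj₂ locally-minimal p q pq∈S (deleteEdge-on-cycle back steiner , ⊆-deleteEdge T S T⊆S pq∉T)

    tree-edge-essential : edge T a b ≡ true → ¬ IsSteinerSubgraph G W (deleteEdge S a b)
    tree-edge-essential {a = a} {b = b} ab∈T steiner-ab =
      let s , s∈W , a⇝s = terminal-beyond acyclic leaves-in-W ab∈T (inj₁ (refl , refl))
          t , t∈W , b⇝t = terminal-beyond acyclic leaves-in-W (trans (edge-sym T b a) ab∈T)
                                                          (inj₂ (refl , refl))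
          s⇝t = proj₁ (steiner-ab s t s∈W t∈W)
      in no-bypass ab∈T (shorten (lift a⇝s ++ʷ (s⇝t ++ʷ reverseʷ (lift b⇝t))))
      where
      lift : Walk (deleteEdge T a b) u v → Walk (deleteEdge S a b) u v
      lift = mapWalk (deleteEdge-mono {T} {S} a b T⊆S)

    tree-edge-kept : ∀ H → H ⊆ₛ S → IsSteinerSubgraph G W H → edge T a b ≡ true → edge H a b ≡ true
    tree-edge-kept {a = a} {b = b} H H⊆S steinerH ab∈T with edge H a b in ab∈H
    ... | true  = refl
    ... | false = ⊥-elim (tree-edge-essential ab∈T
                    (isSteinerSubgraph-mono {K = deleteEdge S a b} (⊆-deleteEdge H S H⊆S ab∈H) steinerH))

    tree-vertex-kept : ∀ H → H ⊆ₛ S → IsSteinerSubgraph G W H → vert T x ≡ true → vert H x ≡ true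
    tree-vertex-kept {x = x} H H⊆S steinerH x∈T with degree T x ≤? 1
    ... | yes leaf = let x∈W = leaves-in-W x (x∈T , leaf) in start-vert (proj₁ (steinerH x x x∈W x∈W))
    ... | no ¬leaf = let y , xy∈T , _ = other-neighbour T x x (≰⇒> ¬leaf) in
                     edge-end H x y (tree-edge-kept H H⊆S steinerH xy∈T)

    isMinimalSteinerTree : IsMinimalSteinerTree G W S
    isMinimalSteinerTree = steiner , no-smaller
      where
      no-smaller : ∀ H → H ⊂ₛ S → ¬ IsSteinerSubgraph G W H
      no-smaller H (H⊆S , S⊈H) steinerH with missing-vertex-or-edge S H S⊈H
      ... | inj₁ (x , x∈S , x∉H) with vert T x in x∈T
      ...   | true  = ≡true⇒≢false (tree-vertex-kept H H⊆S steinerH x∈T) x∉H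
      ...   | false = proj₁ locally-minimal x x∈S
                        ( isSteinerSubgraph-mono {K = deleteVertex S x} (⊆-deleteVertex H S H⊆S x∉H) steinerH
                        , ⊆-deleteVertex T S T⊆S x∈T)
      no-smaller H (H⊆S , S⊈H) steinerH | inj₂ (a , b , ab∈S , ab∉H) with edge T a b in ab∈T
      ...   | true  = ≡true⇒≢false (tree-edge-kept H H⊆S steinerH ab∈T) ab∉H
      ...   | false = proj₂ locally-minimal a b ab∈S
                        ( isSteinerSubgraph-mono {K = deleteEdge S a b} (⊆-deleteEdge H S H⊆S ab∉H) steinerH
                        , ⊆-deleteEdge T S T⊆S ab∈T)

lemma4p1 : ∀ {n} (G : Graph n) (W : Fin n → Bool) → Connected G →
    (T : Subgraph G) → IsPartialSteinerTree G W T →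
    Σ (Subgraph G) λ S → IsMinimalSteinerTree G W S × (T ⊆ₛ S)
lemma4p1 G W connected T ((_ , _ , acyclic) , leaves-in-W) =
  let S , (steiner , T⊆S) , locally-minimal =
        locallyMinimal {H = wholeGraph G} (steinerAbove? W T) (G-steiner , T⊆G)
  in S , isMinimalSteinerTree acyclic leaves-in-W steiner T⊆S locally-minimal , T⊆S
  where
  G-steiner : IsSteinerSubgraph G W (wholeGraph G)
  G-steiner u v _ _ = connected u v refl refl
  T⊆G : T ⊆ₛ wholeGraph G
  T⊆G = (λ _ _ → refl) , edge-adj T
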